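{- Let $\mathbf A$ be an $n\times n$ real skew-symmetric matrix. The following are equivalent: (1) $\mathrm{pf}(\mathbf A[I,I])>0$ for every subset $I\subseteq[n]$ of even size; (2) $\det(\mathbf A[I\cup\{i\},I\cup\{j\}])>0$ for every $I\subseteq[n]$ of even size and all $i<j$ in $[n]\setminus I$ (i.e. every odd-sized top-right almost-principal minor is positive). The same equivalence holds with "$>0$" replaced by "$\ge0$" in both (1) and (2).
   Context: $\mathbf A[R,C]$ denotes the submatrix with rows indexed by $R$ and columns by $C$ (in increasing order). The Pfaffian of the $0\times0$ matrix is $1$ by convention. An almost-principal submatrix $\mathbf A[I\cup\{i\},I\cup\{j\}]$ ($i\neq j$, $i,j\notin I$) is called top-right if $i<j$; it is odd-sized when $|I|$ is even. -}

module Defs where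

open import Level using (Level; _⊔_)
open import Algebra.Bundles using (CommutativeRing)
open import Data.Nat as ℕ using (ℕ; zero; suc)
open import Data.Fin as Fin using (Fin; zero; suc; punchIn; cast)
open import Data.Fin.Subset using (Subset; ∣_∣; _∪_; ⁅_⁆; _∉_; inside; outside; ⊥)
open import Data.Fin.Subset.Properties using (∪-identityʳ)
open import Data.Vec using (_∷_; [])
open import Data.Vec.Relation.Unary.Any using ()
open import Data.Vec.Membership.Propositional using ()
open import Data.Vec.Relation.Unary.All using ()
open import Data.Product using (_×_; _,_; ∃-syntax)
open import Data.Sum using (_⊎_)
open import Relation.Nullary using (¬_)
open import Relation.Binary.PropositionalEquality using (_≡_; refl; cong)
open import Data.Vec.Base using (_[_]=_)
open import Data.Vec.Relation.Unary.Any using ()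

-- Ordered fields.  The statement is about real matrices; we state it for
-- an arbitrary ordered field.

record OrderedField (c ℓ : Level) : Set (Level.suc (c ⊔ ℓ)) where
  field
    commutativeRing : CommutativeRing c ℓ
  open CommutativeRing commutativeRing public
  infix 4 _<_
  field
    _<_          : Carrier → Carrier → Set ℓ
    <-resp-≈     : ∀ {x x′ y y′} → x ≈ x′ → y ≈ y′ → x < y → x′ < y′
    <-irrefl     : ∀ {x} → ¬ (x < x)
    <-trans      : ∀ {x y z} → x < y → y < z → x < z
    <-trichotomy : ∀ x y → x < y ⊎ x ≈ y ⊎ y < x
    +-mono-<     : ∀ {x y} z → x < y → x + z < y + z
    *-pos        : ∀ {x y} → 0# < x → 0# < y → 0# < x * y
    0<1          : 0# < 1#
    inverse      : ∀ x → ¬ (x ≈ 0#) → ∃[ y ] (x * y ≈ 1#)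

  infix 4 _≤_
  _≤_ : Carrier → Carrier → Set ℓ
  x ≤ y = x < y ⊎ x ≈ y

module _ {c ℓ} (F : OrderedField c ℓ) where
  open OrderedField F using (Carrier; _≈_; _+_; _*_; -_; 0#; 1#)

  Matrix : ℕ → ℕ → Set c
  Matrix m n = Fin m → Fin n → Carrier

  SkewSymmetric : ∀ {n} → Matrix n n → Set ℓ
  SkewSymmetric A = ∀ i j → A i j ≈ - A j i

  ∑ : ∀ {k} → (Fin k → Carrier) → Carrier
  ∑ {zero}  f = 0#
  ∑ {suc k} f = f zero + ∑ (λ i → f (suc i))

  sgn : ℕ → Carrier
  sgn zero    = 1#
  sgn (suc m) = - sgn m

  det : ∀ {k} → Matrix k k → Carrier
  det {zero}  M = 1#
  det {suc k} M =
    ∑ (λ j → sgn (Fin.toℕ j) * (M zero j * det (λ a b → M (suc a) (punchIn j b))))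

  -- Pfaffian by expansion along the first row:
  --   pf M = Σ_{j=2}^{k} (-1)^j m_{1j} pf(M with rows/cols 1, j deleted)
  -- (1-indexed); the Pfaffian of an odd-sized matrix is 0, of the 0×0 matrix 1.
  pf : ∀ {k} → Matrix k k → Carrier
  pf {zero}        M = 1#
  pf {suc zero}    M = 0#
  pf {suc (suc k)} M =
    ∑ (λ j → sgn (Fin.toℕ j) *
              (M zero (suc j) * pf (λ a b → M (suc (punchIn j a)) (suc (punchIn j b)))))

enum : ∀ {n} (S : Subset n) → Fin ∣ S ∣ → Fin n
enum (inside  ∷ S) zero    = zero
enum (inside  ∷ S) (suc a) = suc (enum S a)
enum (outside ∷ S) a       = suc (enum S a)

private
  ∣⊥∣ : ∀ {n} → ∣ ⊥ {n} ∣ ≡ 0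
  ∣⊥∣ {zero}  = refl
  ∣⊥∣ {suc n} = ∣⊥∣ {n}

∣∪⁅⁆∣ : ∀ {n} (I : Subset n) (i : Fin n) → i ∉ I → ∣ I ∪ ⁅ i ⁆ ∣ ≡ suc ∣ I ∣
∣∪⁅⁆∣ (inside  ∷ I) zero    i∉I = ⊥-elim′ (i∉I Data.Vec.Base.here)
  where open import Data.Empty renaming (⊥-elim to ⊥-elim′)
∣∪⁅⁆∣ (outside ∷ I) zero    i∉I = cong suc (cong ∣_∣ (∪-identityʳ I))
∣∪⁅⁆∣ (inside  ∷ I) (suc i) i∉I = cong suc (∣∪⁅⁆∣ I i (λ p → i∉I (Data.Vec.Base.there p)))
∣∪⁅⁆∣ (outside ∷ I) (suc i) i∉I = ∣∪⁅⁆∣ I i (λ p → i∉I (Data.Vec.Base.there p))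

module _ {c ℓ} (F : OrderedField c ℓ) where
  open OrderedField F using (Carrier)
  open import Relation.Binary.PropositionalEquality using (trans; sym)

  principalPf : ∀ {n} → Matrix F n n → Subset n → Carrier
  principalPf A I = pf F (λ a b → A (enum I a) (enum I b))

  -- det (A[I ∪ {i}, I ∪ {j}])  (rows and columns in increasing order);
  -- the hypotheses i ∉ I, j ∉ I make the submatrix square.
  almostPrincipalDet : ∀ {n} → Matrix F n n → (I : Subset n) (i j : Fin n) →
                       i ∉ I → j ∉ I → Carrier
  almostPrincipalDet A I i j i∉I j∉I =
    det F (λ a b → A (enum (I ∪ ⁅ i ⁆) a) (enum (I ∪ ⁅ j ⁆) (cast eq b)))
    where
    eq : ∣ I ∪ ⁅ i ⁆ ∣ ≡ ∣ I ∪ ⁅ j ⁆ ∣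
    eq = trans (∣∪⁅⁆∣ I i i∉I) (sym (∣∪⁅⁆∣ I j j∉I))

{-# OPTIONS --safe #-}
module Submission where

open import Defs
open import Data.Nat as ℕ using (ℕ; zero; suc; s≤s)
open import Data.Nat.Divisibility using (_∣_; divides; ∣-refl; ∣m∣n⇒∣m+n)
open import Data.Nat.Properties using (suc-injective)
open import Data.Fin using (Fin; zero; suc; toℕ; punchIn; cast) renaming (_<_ to _<ᶠ_)
open import Data.Fin.Properties using (<-cmp; toℕ<n; toℕ-cast; toℕ-injective) renaming (<-irrefl to <ᶠ-irrefl)
open import Data.Fin.Subset using (Subset; ∣_∣; _∪_; ⁅_⁆; _∈_; _∉_; inside; outside)
open import Data.Fin.Subset.Properties
  using (∪-identityʳ; ∪-assoc; ∪-comm; x∈p∪q⁺; x∈p∪q⁻; x∈⁅x⁆; x∈⁅y⁆⇒x≡y)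
open import Data.Vec.Base using (here; there) renaming (_∷_ to _∷ᵇ_)
open import Data.Vec.Functional using (Vector; _∷_; tail; insertAt; removeAt)
open import Data.Vec.Functional.Properties using (insertAt-lookup; insertAt-punchIn; removeAt-insertAt)
open import Data.Empty using (⊥-elim)
open import Data.Product using (_×_; _,_)
open import Data.Sum using (_⊎_; inj₁; inj₂)
open import Function using (_∘_)
open import Function.Bundles using (_⇔_; mk⇔)
open import Relation.Binary.Definitions using (tri<; tri≈; tri>)
open import Relation.Binary.PropositionalEquality using (_≡_; _≢_; _≗_; refl; cong; subst)
import Relation.Binary.PropositionalEquality as ≡
import Algebra.Solver.CommutativeMonoid as CommutativeMonoidSolver

-- For skew-symmetric A and an index list t of even length,
--   det A[x∷t, y∷t] = pf A[t] · pf A[x∷y∷t],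
-- proved together with its odd-length companion det A[x∷t, y∷t] = pf A[x∷t] · pf A[y∷t]
-- by expanding along the first row and moving the deleted row to the front.  Moving i and j
-- to the front turns the almost-principal minor det A[I ∪ {i}, I ∪ {j}] with i < j into
-- pf A[I] · pf A[I ∪ {i, j}], the two signs cancelling; this gives (1) ⇒ (2) at once.
-- Conversely, induct on |J| and write J = I ∪ {x, y}, so that pf A[I] · pf A[J] is ≥ 0
-- (resp. > 0).  In the strict case pf A[I] > 0 then forces pf A[J] > 0.  In the non-strict
-- case, if pf A[J] < 0 then every pf A[J ∖ {x, y}] with x = min J vanishes; these are exactly
-- the Pfaffians in the first-row expansion of pf A[J], so pf A[J] = 0 after all.

swap : ∀ {k} → Fin k → Fin (suc k) → Fin (suc k)
swap zero    zero          = suc zero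
swap zero    (suc zero)    = zero
swap zero    (suc (suc x)) = suc (suc x)
swap (suc a) zero          = zero
swap (suc a) (suc x)       = suc (swap a x)

Adjacent : ∀ {k} → Fin k → Fin k → Set
Adjacent i j = toℕ i ≡ suc (toℕ j) ⊎ toℕ j ≡ suc (toℕ i)

data SwapPunchIn {k} (a : Fin (suc k)) (j : Fin (suc (suc k))) : Set where
  adjacent : Adjacent j (swap a j) → swap a ∘ punchIn j ≗ punchIn (swap a j) → SwapPunchIn a j
  fixed    : (b : Fin k) → swap a j ≡ j → swap a ∘ punchIn j ≗ punchIn j ∘ swap b → SwapPunchIn a j

swapPunchIn : ∀ {k} (a : Fin (suc k)) (j : Fin (suc (suc k))) → SwapPunchIn a j
swapPunchIn zero zero                  = adjacent (inj₂ refl) λ { zero → refl ; (suc x) → refl }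
swapPunchIn zero (suc zero)            = adjacent (inj₁ refl) λ { zero → refl ; (suc x) → refl }
swapPunchIn {suc k} zero (suc (suc j)) =
  fixed zero refl λ { zero → refl ; (suc zero) → refl ; (suc (suc x)) → refl }
swapPunchIn {suc k} (suc a) zero       = fixed a refl λ x → refl
swapPunchIn {suc k} (suc a) (suc j) with swapPunchIn a j
... | adjacent (inj₁ adj) p = adjacent (inj₁ (cong suc adj)) λ { zero → refl ; (suc x) → cong suc (p x) }
... | adjacent (inj₂ adj) p = adjacent (inj₂ (cong suc adj)) λ { zero → refl ; (suc x) → cong suc (p x) }
... | fixed b fix p         = fixed (suc b) (cong suc fix) λ { zero → refl ; (suc x) → cong suc (p x) }

-- (j , l) codes the ordered pair (j , punchIn j l) of distinct positions, and
-- (punchIn j l , flipCode j l) codes the reversed pair.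
flipCode : ∀ {k} → Fin (suc k) → Fin k → Fin k
flipCode {suc k} zero    l       = zero
flipCode {suc k} (suc j) zero    = j
flipCode {suc k} (suc j) (suc l) = suc (flipCode j l)

punchIn-flipCode : ∀ {k} (j : Fin (suc k)) (l : Fin k) → punchIn (punchIn j l) (flipCode j l) ≡ j
punchIn-flipCode {suc k} zero    l       = refl
punchIn-flipCode {suc k} (suc j) zero    = refl
punchIn-flipCode {suc k} (suc j) (suc l) = cong suc (punchIn-flipCode j l)

punchIn-punchIn-flipCode : ∀ {k} (j : Fin (suc (suc k))) (l : Fin (suc k)) →
                           punchIn j ∘ punchIn l ≗ punchIn (punchIn j l) ∘ punchIn (flipCode j l)
punchIn-punchIn-flipCode zero    l       x               = refl
punchIn-punchIn-flipCode (suc j) zero    x               = refl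
punchIn-punchIn-flipCode {suc k} (suc j) (suc l) zero    = refl
punchIn-punchIn-flipCode {suc k} (suc j) (suc l) (suc x) = cong suc (punchIn-punchIn-flipCode j l x)

removeAt-∷-suc : ∀ {A : Set} {k} (y : A) (t : Vector A (suc k)) m → removeAt (y ∷ t) (suc m) ≗ y ∷ removeAt t m
removeAt-∷-suc y t m zero    = refl
removeAt-∷-suc y t m (suc a) = refl

head∷tail : ∀ {A : Set} {k} (t : Vector A (suc k)) → t ≗ t zero ∷ tail t
head∷tail t zero    = refl
head∷tail t (suc a) = refl

insertAt-map : ∀ {A B : Set} {k} (f : A → B) (xs : Vector A k) i x →
               insertAt (f ∘ xs) i (f x) ≗ f ∘ insertAt xs i x
insertAt-map             f xs zero    x zero    = refl
insertAt-map             f xs zero    x (suc a) = refl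
insertAt-map {k = suc k} f xs (suc i) x zero    = refl
insertAt-map {k = suc k} f xs (suc i) x (suc a) = insertAt-map f (tail xs) i x a

-- Pointwise equality of vectors whose lengths are only propositionally equal,
-- such as enum (S ∪ ⁅ x ⁆) and a vector of length suc ∣ S ∣.
infix 4 _≗ʰ_
_≗ʰ_ : ∀ {A : Set} {k m} → Vector A k → Vector A m → Set
s ≗ʰ t = ∀ {a b} → toℕ a ≡ toℕ b → s a ≡ t b

≗ʰ-sym : ∀ {A : Set} {k m} {s : Vector A k} {t : Vector A m} → s ≗ʰ t → t ≗ʰ s
≗ʰ-sym s≗t a≡b = ≡.sym (s≗t (≡.sym a≡b))

≗ʰ-cast : ∀ {A : Set} {k m l} (e : k ≡ m) {s : Vector A m} {t : Vector A l} → s ≗ʰ t → s ∘ cast e ≗ʰ t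
≗ʰ-cast e s≗t {a} a≡b = s≗t (≡.trans (toℕ-cast e a) a≡b)

∷-≗ʰ : ∀ {A : Set} {k m} {s : Vector A k} {t : Vector A m} x → s ≗ʰ t → x ∷ s ≗ʰ x ∷ t
∷-≗ʰ x s≗t {zero}  {zero}  _   = refl
∷-≗ʰ x s≗t {suc a} {suc b} a≡b = s≗t (suc-injective a≡b)

toℕ-punchIn-cong : ∀ {k m} {l : Fin (suc k)} {p : Fin (suc m)} {a : Fin k} {b : Fin m} →
                   toℕ l ≡ toℕ p → toℕ a ≡ toℕ b → toℕ (punchIn l a) ≡ toℕ (punchIn p b)
toℕ-punchIn-cong {l = zero}  {zero}                  _   a≡b = cong suc a≡b
toℕ-punchIn-cong {l = suc l} {suc p} {zero}  {zero}  _   _   = refl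
toℕ-punchIn-cong {l = suc l} {suc p} {suc a} {suc b} l≡p a≡b =
  cong suc (toℕ-punchIn-cong (suc-injective l≡p) (suc-injective a≡b))

removeAt-≗ʰ : ∀ {A : Set} {k m} {s : Vector A (suc k)} {t : Vector A m} {p x} {l : Fin (suc k)} →
              s ≗ʰ insertAt t p x → toℕ l ≡ toℕ p → removeAt s l ≗ʰ t
removeAt-≗ʰ {t = t} {p} {x} s≗ l≡p {b = b} a≡b = ≡.trans (s≗ (toℕ-punchIn-cong l≡p a≡b)) (insertAt-punchIn t p x b)

-- Subsets and their increasing enumerations

rank : ∀ {n} (S : Subset n) → Fin n → Fin (suc ∣ S ∣)
rank (_       ∷ᵇ S) zero    = zero
rank (inside  ∷ᵇ S) (suc x) = suc (rank S x)
rank (outside ∷ᵇ S) (suc x) = rank S x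

enum-cong : ∀ {n} {S T : Subset n} → S ≡ T → enum S ≗ʰ enum T
enum-cong {S = S} refl a≡b = cong (enum S) (toℕ-injective a≡b)

enum-∪⁅⁆ : ∀ {n} (S : Subset n) (x : Fin n) → x ∉ S → enum (S ∪ ⁅ x ⁆) ≗ʰ insertAt (enum S) (rank S x) x
enum-∪⁅⁆ (inside  ∷ᵇ S) zero    x∉S = ⊥-elim (x∉S here)
enum-∪⁅⁆ (outside ∷ᵇ S) zero    x∉S {zero}  {zero}  _   = refl
enum-∪⁅⁆ (outside ∷ᵇ S) zero    x∉S {suc a} {suc b} a≡b = cong suc (enum-cong (∪-identityʳ S) (suc-injective a≡b))
enum-∪⁅⁆ (inside  ∷ᵇ S) (suc x) x∉S {zero}  {zero}  _   = refl
enum-∪⁅⁆ (inside  ∷ᵇ S) (suc x) x∉S {suc a} {suc b} a≡b =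
  ≡.trans (cong suc (enum-∪⁅⁆ S x (x∉S ∘ there) (suc-injective a≡b)))
          (≡.sym (insertAt-map suc (enum S) (rank S x) x b))
enum-∪⁅⁆ (outside ∷ᵇ S) (suc x) x∉S {b = b} a≡b =
  ≡.trans (cong suc (enum-∪⁅⁆ S x (x∉S ∘ there) a≡b))
          (≡.sym (insertAt-map suc (enum S) (rank S x) x b))

rank-∪⁅⁆ : ∀ {n} (S : Subset n) {i j : Fin n} → i ∉ S → i <ᶠ j →
           toℕ (rank (S ∪ ⁅ i ⁆) j) ≡ suc (toℕ (rank S j))
rank-∪⁅⁆ (inside  ∷ᵇ S) {zero}          i∉S _         = ⊥-elim (i∉S here)
rank-∪⁅⁆ (outside ∷ᵇ S) {zero}  {suc j} i∉S _         = cong (λ T → suc (toℕ (rank T j))) (∪-identityʳ S)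
rank-∪⁅⁆ (inside  ∷ᵇ S) {suc i} {suc j} i∉S (s≤s i<j) = cong suc (rank-∪⁅⁆ S (i∉S ∘ there) i<j)
rank-∪⁅⁆ (outside ∷ᵇ S) {suc i} {suc j} i∉S (s≤s i<j) = rank-∪⁅⁆ S (i∉S ∘ there) i<j

∉-∪⁅⁆ : ∀ {n} (I : Subset n) {i j : Fin n} → j ∉ I → i <ᶠ j → j ∉ I ∪ ⁅ i ⁆
∉-∪⁅⁆ I {i} j∉I i<j j∈ with x∈p∪q⁻ I ⁅ i ⁆ j∈
... | inj₁ j∈I   = j∉I j∈I
... | inj₂ j∈⁅i⁆ = <ᶠ-irrefl (≡.sym (x∈⁅y⁆⇒x≡y i j∈⁅i⁆)) i<j

∪⁅⁆-swap : ∀ {n} (I : Subset n) a b → (I ∪ ⁅ a ⁆) ∪ ⁅ b ⁆ ≡ (I ∪ ⁅ b ⁆) ∪ ⁅ a ⁆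
∪⁅⁆-swap I a b = ≡.trans (∪-assoc I ⁅ a ⁆ ⁅ b ⁆)
                         (≡.trans (cong (I ∪_) (∪-comm ⁅ a ⁆ ⁅ b ⁆)) (≡.sym (∪-assoc I ⁅ b ⁆ ⁅ a ⁆)))

∣∪⁅⁆∪⁅⁆∣ : ∀ {n} (I : Subset n) {i j : Fin n} → i ∉ I → j ∉ I → i <ᶠ j → ∣ (I ∪ ⁅ i ⁆) ∪ ⁅ j ⁆ ∣ ≡ 2 ℕ.+ ∣ I ∣
∣∪⁅⁆∪⁅⁆∣ I {i} {j} i∉I j∉I i<j = ≡.trans (∣∪⁅⁆∣ (I ∪ ⁅ i ⁆) j (∉-∪⁅⁆ I j∉I i<j)) (cong suc (∣∪⁅⁆∣ I i i∉I))

record Extraction {n} (J : Subset n) (p : ℕ) : Set where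
  field
    rest  : Subset n
    elem  : Fin n
    elem∉ : elem ∉ rest
    J≡    : J ≡ rest ∪ ⁅ elem ⁆
    rank≡ : toℕ (rank rest elem) ≡ p

extract : ∀ {n} (J : Subset n) (p : ℕ) → p ℕ.< ∣ J ∣ → Extraction J p
extract (inside ∷ᵇ J) zero _ = record
  { rest = outside ∷ᵇ J ; elem = zero ; elem∉ = λ () ; J≡ = cong (inside ∷ᵇ_) (≡.sym (∪-identityʳ J)) ; rank≡ = refl }
extract (inside ∷ᵇ J) (suc p) (s≤s p<∣J∣) = record
  { rest = inside ∷ᵇ rest ; elem = suc elem ; elem∉ = λ { (there x∈) → elem∉ x∈ }
  ; J≡ = cong (inside ∷ᵇ_) J≡ ; rank≡ = cong suc rank≡ }
  where open Extraction (extract J p p<∣J∣)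
extract (outside ∷ᵇ J) p p<∣J∣ = record
  { rest = outside ∷ᵇ rest ; elem = suc elem ; elem∉ = λ { (there x∈) → elem∉ x∈ }
  ; J≡ = cong (outside ∷ᵇ_) J≡ ; rank≡ = rank≡ }
  where open Extraction (extract J p p<∣J∣)

extractAt : ∀ {n m} (J : Subset n) → ∣ J ∣ ≡ suc m → (l : Fin (suc m)) → Extraction J (toℕ l)
extractAt J ∣J∣≡ l = extract J (toℕ l) (subst (toℕ l ℕ.<_) (≡.sym ∣J∣≡) (toℕ<n l))

module _ {n} {J : Subset n} {p} (e : Extraction J p) where
  open Extraction e

  extraction-size : ∣ J ∣ ≡ suc ∣ rest ∣
  extraction-size = ≡.trans (cong ∣_∣ J≡) (∣∪⁅⁆∣ rest elem elem∉)

  rest-size : ∀ {m} → ∣ J ∣ ≡ suc m → ∣ rest ∣ ≡ m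
  rest-size ∣J∣≡ = suc-injective (≡.trans (≡.sym extraction-size) ∣J∣≡)

  enum-extraction : enum J ≗ʰ insertAt (enum rest) (rank rest elem) elem
  enum-extraction =
    subst (λ S → enum S ≗ʰ insertAt (enum rest) (rank rest elem) elem) (≡.sym J≡) (enum-∪⁅⁆ rest elem elem∉)

module _ {n} {J : Subset n} {p p′} (ex : Extraction J p) (ey : Extraction (Extraction.rest ex) p′) where
  private
    module X = Extraction ex
    module Y = Extraction ey

    inner∈outer-rest : Y.elem ∈ X.rest
    inner∈outer-rest = subst (Y.elem ∈_) (≡.sym Y.J≡) (x∈p∪q⁺ (inj₂ (x∈⁅x⁆ Y.elem)))

  outer∉inner-rest : X.elem ∉ Y.rest
  outer∉inner-rest x∈ = X.elem∉ (subst (X.elem ∈_) (≡.sym Y.J≡) (x∈p∪q⁺ (inj₁ x∈)))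

  inner≢outer : Y.elem ≢ X.elem
  inner≢outer y≡x = X.elem∉ (subst (_∈ X.rest) y≡x inner∈outer-rest)

  nested-extraction-≡ : J ≡ (Y.rest ∪ ⁅ Y.elem ⁆) ∪ ⁅ X.elem ⁆
  nested-extraction-≡ = ≡.trans X.J≡ (cong (_∪ ⁅ X.elem ⁆) Y.J≡)

-- Finite sums, signs and first-row expansions

module _ {c ℓ} (F : OrderedField c ℓ) where
  open OrderedField F hiding (zero) renaming (refl to ≈-refl)
  open import Relation.Binary.Reasoning.Setoid setoid
  open import Algebra.Properties.Ring ring using (-‿distribˡ-*; -‿distribʳ-*; -‿involutive; -0#≈0#; -‿+-comm)
  open import Algebra.Properties.CommutativeSemigroup +-commutativeSemigroup
    using () renaming (x∙yz≈y∙xz to x+[y+z]≈y+[x+z])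
  open import Algebra.Properties.Semiring.Sum semiring
    using (sum; sum-cong-≋; ∑-distrib-+; *-distribˡ-sum; *-distribʳ-sum; sum-replicate-zero)
  open CommutativeMonoidSolver *-commutativeMonoid using (solve; _⊜_) renaming (_⊕_ to _⊛_)

  ∑≡sum : ∀ {k} (f : Vector Carrier k) → ∑ F f ≡ sum f
  ∑≡sum {zero}  f = ≡.refl
  ∑≡sum {suc k} f = ≡.cong (f zero +_) (∑≡sum (f ∘ suc))

  ∑-cong : ∀ {k} {f g : Vector Carrier k} → (∀ i → f i ≈ g i) → ∑ F f ≈ ∑ F g
  ∑-cong {f = f} {g} f≈g rewrite ∑≡sum f | ∑≡sum g = sum-cong-≋ f≈g

  ∑-+ : ∀ {k} (f g : Vector Carrier k) → ∑ F (λ i → f i + g i) ≈ ∑ F f + ∑ F g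
  ∑-+ f g rewrite ∑≡sum (λ i → f i + g i) | ∑≡sum f | ∑≡sum g = ∑-distrib-+ f g

  *-∑ : ∀ {k} x (f : Vector Carrier k) → x * ∑ F f ≈ ∑ F (λ i → x * f i)
  *-∑ x f rewrite ∑≡sum f | ∑≡sum (λ i → x * f i) = *-distribˡ-sum x f

  ∑-* : ∀ {k} (f : Vector Carrier k) x → ∑ F f * x ≈ ∑ F (λ i → f i * x)
  ∑-* f x rewrite ∑≡sum f | ∑≡sum (λ i → f i * x) = *-distribʳ-sum x f

  ∑-neg : ∀ {k} (f : Vector Carrier k) → ∑ F (λ i → - f i) ≈ - ∑ F f
  ∑-neg {zero}  f = sym -0#≈0#
  ∑-neg {suc k} f = trans (+-congˡ (∑-neg (f ∘ suc))) (-‿+-comm _ _)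

  ∑-zero : ∀ {k} → ∑ F {k} (λ _ → 0#) ≈ 0#
  ∑-zero {k} rewrite ∑≡sum {k} (λ _ → 0#) = sum-replicate-zero k

  ∑-swap : ∀ {k} (a : Fin k) (f : Vector Carrier (suc k)) → ∑ F (f ∘ swap a) ≈ ∑ F f
  ∑-swap zero    f = x+[y+z]≈y+[x+z] _ _ _
  ∑-swap (suc a) f = +-congˡ (∑-swap a (f ∘ suc))

  ∑∑-flip : ∀ {k} (G : Fin (suc k) → Fin k → Carrier) →
            ∑ F (λ j → ∑ F (G j)) ≈ ∑ F (λ j → ∑ F (λ l → G (punchIn j l) (flipCode j l)))
  ∑∑-flip {zero}  G = ≈-refl
  ∑∑-flip {suc k} G = begin
      ∑ F (G zero) + ∑ F (λ j → G (suc j) zero + ∑ F (G′ j))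
    ≈⟨ +-congˡ (trans (∑-+ (λ j → G (suc j) zero) (λ j → ∑ F (G′ j))) (+-congˡ (∑∑-flip G′))) ⟩
      ∑ F (G zero) + (∑ F (λ j → G (suc j) zero) + ∑ F (λ j → ∑ F (λ l → G′ (punchIn j l) (flipCode j l))))
    ≈⟨ x+[y+z]≈y+[x+z] _ _ _ ⟩
      ∑ F (λ j → G (suc j) zero) + (∑ F (G zero) + ∑ F (λ j → ∑ F (λ l → G′ (punchIn j l) (flipCode j l))))
    ≈⟨ +-congˡ (sym (∑-+ (G zero) (λ j → ∑ F (λ l → G′ (punchIn j l) (flipCode j l))))) ⟩
      ∑ F (λ j → G (suc j) zero) + ∑ F (λ j → G zero j + ∑ F (λ l → G′ (punchIn j l) (flipCode j l)))
    ∎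
    where
    G′ : Fin (suc k) → Fin k → Carrier
    G′ j l = G (suc j) (suc l)

  sign : ∀ {k} → Fin k → Carrier
  sign j = sgn F (toℕ j)

  -x*-y≈x*y : ∀ x y → (- x) * (- y) ≈ x * y
  -x*-y≈x*y x y = trans (sym (-‿distribˡ-* x (- y))) (trans (-‿cong (sym (-‿distribʳ-* x y))) (-‿involutive _))

  x*[y*-z]≈-[x*[y*z]] : ∀ x y z → x * (y * - z) ≈ - (x * (y * z))
  x*[y*-z]≈-[x*[y*z]] x y z = trans (*-congˡ (sym (-‿distribʳ-* y z))) (sym (-‿distribʳ-* x _))

  sgn-square : ∀ m → sgn F m * sgn F m ≈ 1#
  sgn-square zero    = *-identityˡ 1#
  sgn-square (suc m) = trans (-x*-y≈x*y _ _) (sgn-square m)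

  sign-adjacent : ∀ {k} {i j : Fin k} → Adjacent i j → sign i ≈ - sign j
  sign-adjacent (inj₁ i≡1+j) = reflexive (≡.cong (sgn F) i≡1+j)
  sign-adjacent (inj₂ j≡1+i) = sym (trans (-‿cong (reflexive (≡.cong (sgn F) j≡1+i))) (-‿involutive _))

  sign-flipCode : ∀ {k} (j : Fin (suc k)) (l : Fin k) →
                  sign (punchIn j l) * sign (flipCode j l) ≈ - (sign j * sign l)
  sign-flipCode {suc k} zero    l       = trans (*-identityʳ _) (-‿cong (sym (*-identityˡ _)))
  sign-flipCode {suc k} (suc j) zero    = trans (*-identityˡ _) (sym (trans (-‿cong (*-identityʳ _)) (-‿involutive _)))
  sign-flipCode {suc k} (suc j) (suc l) =
    trans (-x*-y≈x*y _ _) (trans (sign-flipCode j l) (-‿cong (sym (-x*-y≈x*y _ _))))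

  sign-swap-sides : ∀ {k} (m : Fin k) {x y} → x ≈ sign m * y → y ≈ sign m * x
  sign-swap-sides m {x} {y} x≈my = sym (begin
    sign m * x             ≈⟨ *-congˡ x≈my ⟩
    sign m * (sign m * y)  ≈⟨ *-assoc _ _ _ ⟨
    sign m * sign m * y    ≈⟨ *-congʳ (sgn-square (toℕ m)) ⟩
    1# * y                 ≈⟨ *-identityˡ y ⟩
    y                      ∎)

  ∑-sign-suc : ∀ {k} (f : Vector Carrier k) → ∑ F (λ m → sign (suc m) * f m) ≈ - ∑ F (λ m → sign m * f m)
  ∑-sign-suc f = trans (∑-cong (λ m → sym (-‿distribˡ-* (sign m) (f m)))) (∑-neg (λ m → sign m * f m))

  pairSum : ∀ {k} → (Fin (suc k) → Fin (suc k) → Carrier) → (Fin (suc k) → Fin k → Carrier) → Carrier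
  pairSum g R = ∑ F (λ j → ∑ F (λ l → (sign j * sign l) * (g j (punchIn j l) * R j l)))

  pairSum-flip : ∀ {k} {g g′ : Fin (suc k) → Fin (suc k) → Carrier} {R : Fin (suc k) → Fin k → Carrier} →
                 (∀ a b → g′ a b ≈ g b a) → (∀ j l → R (punchIn j l) (flipCode j l) ≈ R j l) →
                 pairSum g′ R ≈ - pairSum g R
  pairSum-flip {k} {g} {g′} {R} g′≈gᵀ R-sym = begin
      ∑ F (λ j → ∑ F (G′ j))
    ≈⟨ ∑∑-flip G′ ⟩
      ∑ F (λ j → ∑ F (λ l → G′ (punchIn j l) (flipCode j l)))
    ≈⟨ ∑-cong (λ j → ∑-cong (flipped j)) ⟩
      ∑ F (λ j → ∑ F (λ l → - G j l))
    ≈⟨ ∑-cong (λ j → ∑-neg (G j)) ⟩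
      ∑ F (λ j → - ∑ F (G j))
    ≈⟨ ∑-neg (λ j → ∑ F (G j)) ⟩
      - pairSum g R
    ∎
    where
    G G′ : Fin (suc k) → Fin k → Carrier
    G  j l = (sign j * sign l) * (g j (punchIn j l) * R j l)
    G′ j l = (sign j * sign l) * (g′ j (punchIn j l) * R j l)
    flipped : ∀ j l → G′ (punchIn j l) (flipCode j l) ≈ - G j l
    flipped j l = begin
        (sign (punchIn j l) * sign (flipCode j l))
          * (g′ (punchIn j l) (punchIn (punchIn j l) (flipCode j l)) * R (punchIn j l) (flipCode j l))
      ≈⟨ *-cong (sign-flipCode j l)
                (*-cong (trans (g′≈gᵀ _ _) (reflexive (≡.cong (λ i → g i (punchIn j l)) (punchIn-flipCode j l))))
                        (R-sym j l)) ⟩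
        (- (sign j * sign l)) * (g j (punchIn j l) * R j l)
      ≈⟨ -‿distribˡ-* _ _ ⟨
        - G j l
      ∎

  module _ {X : Set} where

    Extensional : ∀ {k} → (Vector X k → Carrier) → Set ℓ
    Extensional Φ = ∀ {u v} → u ≗ v → Φ u ≈ Φ v

    Alternating : ∀ {k} → (Vector X (suc k) → Carrier) → Set ℓ
    Alternating Φ = ∀ u a → Φ (u ∘ swap a) ≈ - Φ u

    cons-extensional : ∀ {k} {Φ : Vector X (suc k) → Carrier} x → Extensional Φ → Extensional (Φ ∘ (x ∷_))
    cons-extensional x ext u≗v = ext λ { zero → ≡.refl ; (suc a) → u≗v a }

    cons-alternating : ∀ {k} {Φ : Vector X (suc (suc k)) → Carrier} x →
                       Extensional Φ → Alternating Φ → Alternating (Φ ∘ (x ∷_))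
    cons-alternating x ext alt u a =
      trans (ext λ { zero → ≡.refl ; (suc b) → ≡.refl }) (alt (x ∷ u) (suc a))

    front-sign : ∀ {k} {Φ : Vector X (suc k) → Carrier} → Extensional Φ → Alternating Φ →
                 ∀ u m → Φ (u m ∷ removeAt u m) ≈ sign m * Φ u
    front-sign ext alt u zero = trans (ext λ { zero → ≡.refl ; (suc a) → ≡.refl }) (sym (*-identityˡ _))
    front-sign {suc k} {Φ} ext alt u (suc m) = begin
        Φ (u (suc m) ∷ removeAt u (suc m))
      ≈⟨ ext (λ { zero → ≡.refl ; (suc zero) → ≡.refl ; (suc (suc a)) → ≡.refl }) ⟩
        Φ ((u zero ∷ u (suc m) ∷ removeAt (u ∘ suc) m) ∘ swap zero)
      ≈⟨ alt _ zero ⟩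
        - Φ (u zero ∷ u (suc m) ∷ removeAt (u ∘ suc) m)
      ≈⟨ -‿cong (front-sign (cons-extensional (u zero) ext) (cons-alternating (u zero) ext alt) (u ∘ suc) m) ⟩
        - (sign m * Φ (u zero ∷ u ∘ suc))
      ≈⟨ -‿cong (*-congˡ (ext λ { zero → ≡.refl ; (suc a) → ≡.refl })) ⟩
        - (sign m * Φ u)
      ≈⟨ -‿distribˡ-* _ _ ⟩
        sign (suc m) * Φ u
      ∎

    insertAt-sign : ∀ {k} {Φ : Vector X (suc k) → Carrier} → Extensional Φ → Alternating Φ →
                    ∀ v p x → Φ (insertAt v p x) ≈ sign p * Φ (x ∷ v)
    insertAt-sign ext alt v p x = sign-swap-sides p (trans (ext toFront) (front-sign ext alt (insertAt v p x) p))
      where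
      toFront : x ∷ v ≗ insertAt v p x p ∷ removeAt (insertAt v p x) p
      toFront zero    = ≡.sym (insertAt-lookup v p x)
      toFront (suc a) = ≡.sym (removeAt-insertAt v p x a)

    -- det and pf unfold definitionally to first-row expansions of this form.
    laplace : ∀ {k} → (X → Carrier) → (Vector X k → Carrier) → Vector X (suc k) → Carrier
    laplace h Φ u = ∑ F (λ j → sign j * (h (u j) * Φ (removeAt u j)))

    laplace-alternating : ∀ {k} (h : X → Carrier) {Φ : Vector X (suc k) → Carrier} →
                          Extensional Φ → Alternating Φ → Alternating (laplace h Φ)
    laplace-alternating h {Φ} ext alt u a = begin
        ∑ F (λ j → sign j * (h (u (swap a j)) * Φ (u ∘ swap a ∘ punchIn j)))
      ≈⟨ ∑-cong swapped ⟩
        ∑ F (λ j → - term (swap a j))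
      ≈⟨ ∑-neg (term ∘ swap a) ⟩
        - ∑ F (term ∘ swap a)
      ≈⟨ -‿cong (∑-swap a term) ⟩
        - ∑ F term
      ∎
      where
      term : Vector Carrier _
      term j = sign j * (h (u j) * Φ (removeAt u j))
      swapped : ∀ j → sign j * (h (u (swap a j)) * Φ (u ∘ swap a ∘ punchIn j)) ≈ - term (swap a j)
      swapped j with swapPunchIn a j
      ... | adjacent adj p = trans (*-cong (sign-adjacent adj) (*-congˡ (ext (≡.cong u ∘ p)))) (sym (-‿distribˡ-* _ _))
      ... | fixed b fix p rewrite fix = begin
          sign j * (h (u j) * Φ (u ∘ swap a ∘ punchIn j))
        ≈⟨ *-congˡ (*-congˡ (trans (ext (≡.cong u ∘ p)) (alt (removeAt u j) b))) ⟩
          sign j * (h (u j) * - Φ (removeAt u j))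
        ≈⟨ x*[y*-z]≈-[x*[y*z]] _ _ _ ⟩
          - term j
        ∎

    laplace-extensional : ∀ {k} (h : X → Carrier) {Φ : Vector X k → Carrier} → Extensional Φ → Extensional (laplace h Φ)
    laplace-extensional h {Φ} ext {u} {v} u≗v = ∑-cong termwise
      where
      termwise : ∀ j → sign j * (h (u j) * Φ (removeAt u j)) ≈ sign j * (h (v j) * Φ (removeAt v j))
      termwise j = *-congˡ (*-cong (reflexive (≡.cong h (u≗v j))) (ext (u≗v ∘ punchIn j)))

    laplace-cong : ∀ {k} (h : X → Carrier) {Φ Ψ : Vector X k → Carrier} (u : Vector X (suc k)) →
                   (∀ j → Φ (removeAt u j) ≈ Ψ (removeAt u j)) → laplace h Φ u ≈ laplace h Ψ u
    laplace-cong h {Φ} {Ψ} u Φ≈Ψ = ∑-cong termwise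
      where
      termwise : ∀ j → sign j * (h (u j) * Φ (removeAt u j)) ≈ sign j * (h (u j) * Ψ (removeAt u j))
      termwise j = *-congˡ (*-congˡ (Φ≈Ψ j))

    laplace-neg : ∀ {k} (h : X → Carrier) {Φ Ψ : Vector X k → Carrier} (u : Vector X (suc k)) →
                  (∀ j → Φ (removeAt u j) ≈ - Ψ (removeAt u j)) → laplace h Φ u ≈ - laplace h Ψ u
    laplace-neg h {Φ} {Ψ} u Φ≈-Ψ = begin
      laplace h Φ u                                              ≈⟨ laplace-cong h {Φ} {λ w → - Ψ w} u Φ≈-Ψ ⟩
      ∑ F (λ j → sign j * (h (u j) * - Ψ (removeAt u j)))        ≈⟨ ∑-cong (λ j → x*[y*-z]≈-[x*[y*z]] (sign j) (h (u j)) (Ψ (removeAt u j))) ⟩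
      ∑ F (λ j → - (sign j * (h (u j) * Ψ (removeAt u j))))      ≈⟨ ∑-neg (λ j → sign j * (h (u j) * Ψ (removeAt u j))) ⟩
      - laplace h Ψ u                                            ∎

    laplace-zero : ∀ {k} (h : X → Carrier) {Φ : Vector X k → Carrier} (u : Vector X (suc k)) →
                   (∀ j → Φ (removeAt u j) ≈ 0#) → laplace h Φ u ≈ 0#
    laplace-zero {k} h {Φ} u Φ≈0 = begin
      laplace h Φ u                               ≈⟨ laplace-cong h {Φ} {λ _ → 0#} u Φ≈0 ⟩
      ∑ F (λ j → sign j * (h (u j) * 0#))         ≈⟨ ∑-cong (λ j → trans (*-congˡ (zeroʳ (h (u j)))) (zeroʳ (sign j))) ⟩
      ∑ F {suc k} (λ _ → 0#)                      ≈⟨ ∑-zero {suc k} ⟩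
      0#                                          ∎

    laplace-laplace : ∀ {k} (h h′ : X → Carrier) (Ψ : Vector X k → Carrier) (u : Vector X (suc (suc k))) →
      laplace h (laplace h′ Ψ) u ≈ pairSum (λ a b → h (u a) * h′ (u b)) (λ j l → Ψ (removeAt (removeAt u j) l))
    laplace-laplace h h′ Ψ u = ∑-cong expand
      where
      expand : ∀ j → sign j * (h (u j) * laplace h′ Ψ (removeAt u j)) ≈
                     ∑ F (λ l → (sign j * sign l) * ((h (u j) * h′ (u (punchIn j l))) * Ψ (removeAt (removeAt u j) l)))
      expand j = begin
          sign j * (h (u j) * ∑ F (λ l → sign l * b l))
        ≈⟨ *-congˡ (*-∑ (h (u j)) (λ l → sign l * b l)) ⟩
          sign j * ∑ F (λ l → h (u j) * (sign l * b l))
        ≈⟨ *-∑ (sign j) (λ l → h (u j) * (sign l * b l)) ⟩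
          ∑ F (λ l → sign j * (h (u j) * (sign l * b l)))
        ≈⟨ ∑-cong (λ l → solve 5 (λ s a t x y → (s ⊛ (a ⊛ (t ⊛ (x ⊛ y)))) ⊜ ((s ⊛ t) ⊛ ((a ⊛ x) ⊛ y))) ≈-refl
                           (sign j) (h (u j)) (sign l) (h′ (u (punchIn j l))) (Ψ (removeAt (removeAt u j) l))) ⟩
          ∑ F (λ l → (sign j * sign l) * ((h (u j) * h′ (u (punchIn j l))) * Ψ (removeAt (removeAt u j) l)))
        ∎
        where
        b : _ → Carrier
        b l = h′ (u (punchIn j l)) * Ψ (removeAt (removeAt u j) l)

    laplace-laplace-anticomm : ∀ {k} (h h′ : X → Carrier) {Ψ : Vector X k → Carrier} → Extensional Ψ →
      ∀ u → laplace h (laplace h′ Ψ) u ≈ - laplace h′ (laplace h Ψ) u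
    laplace-laplace-anticomm {k} h h′ {Ψ} ext u = begin
        laplace h (laplace h′ Ψ) u
      ≈⟨ laplace-laplace h h′ Ψ u ⟩
        pairSum (λ a b → h (u a) * h′ (u b)) R
      ≈⟨ pairSum-flip (λ a b → *-comm (h (u a)) (h′ (u b))) R-sym ⟩
        - pairSum (λ a b → h′ (u a) * h (u b)) R
      ≈⟨ -‿cong (laplace-laplace h′ h Ψ u) ⟨
        - laplace h′ (laplace h Ψ) u
      ∎
      where
      R : Fin (suc (suc k)) → Fin (suc k) → Carrier
      R j l = Ψ (removeAt (removeAt u j) l)
      R-sym : ∀ j l → R (punchIn j l) (flipCode j l) ≈ R j l
      R-sym j l = ext (≡.cong u ∘ ≡.sym ∘ punchIn-punchIn-flipCode j l)

    laplace-cons : ∀ {k} (h : X → Carrier) {Φ : Vector X (suc k) → Carrier} → Extensional Φ →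
                   ∀ y (t : Vector X (suc k)) →
                   laplace h Φ (y ∷ t) ≈ h y * Φ t + - ∑ F (λ m → sign m * (h (t m) * Φ (y ∷ removeAt t m)))
    laplace-cons h {Φ} ext y t = +-cong (*-identityˡ _) (begin
        ∑ F (λ m → sign (suc m) * (h (t m) * Φ (removeAt (y ∷ t) (suc m))))
      ≈⟨ ∑-cong shifted ⟩
        ∑ F (λ m → sign (suc m) * (h (t m) * Φ (y ∷ removeAt t m)))
      ≈⟨ ∑-sign-suc (λ m → h (t m) * Φ (y ∷ removeAt t m)) ⟩
        - ∑ F (λ m → sign m * (h (t m) * Φ (y ∷ removeAt t m)))
      ∎)
      where
      shifted : ∀ m → sign (suc m) * (h (t m) * Φ (removeAt (y ∷ t) (suc m)))
                    ≈ sign (suc m) * (h (t m) * Φ (y ∷ removeAt t m))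
      shifted m = *-congˡ (*-congˡ (ext (removeAt-∷-suc y t m)))

  neg-pos : ∀ {x} → x < 0# → 0# < - x
  neg-pos {x} x<0 = <-resp-≈ (-‿inverseʳ x) (+-identityˡ (- x)) (+-mono-< (- x) x<0)

  pos-neg : ∀ {x} → 0# < x → - x < 0#
  pos-neg {x} 0<x = <-resp-≈ (+-identityˡ (- x)) (-‿inverseʳ x) (+-mono-< (- x) 0<x)

  x≈-x⇒x≈0 : ∀ {x} → x ≈ - x → x ≈ 0#
  x≈-x⇒x≈0 {x} x≈-x with <-trichotomy x 0#
  ... | inj₁ x<0        = ⊥-elim (<-irrefl (<-trans x<0 (<-resp-≈ ≈-refl (sym x≈-x) (neg-pos x<0))))
  ... | inj₂ (inj₁ x≈0) = x≈0
  ... | inj₂ (inj₂ 0<x) = ⊥-elim (<-irrefl (<-trans 0<x (<-resp-≈ (sym x≈-x) ≈-refl (pos-neg 0<x))))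

  pos-resp : ∀ {a b} → a ≈ b → 0# < a → 0# < b
  pos-resp = <-resp-≈ ≈-refl

  nonneg-resp : ∀ {a b} → a ≈ b → 0# ≤ a → 0# ≤ b
  nonneg-resp a≈b (inj₁ 0<a) = inj₁ (pos-resp a≈b 0<a)
  nonneg-resp a≈b (inj₂ 0≈a) = inj₂ (trans 0≈a a≈b)

  nonneg-* : ∀ {a b} → 0# ≤ a → 0# ≤ b → 0# ≤ a * b
  nonneg-*         (inj₁ 0<a) (inj₁ 0<b) = inj₁ (*-pos 0<a 0<b)
  nonneg-* {b = b} (inj₂ 0≈a) _          = inj₂ (trans (sym (zeroˡ b)) (*-congʳ 0≈a))
  nonneg-* {a}     (inj₁ _)   (inj₂ 0≈b) = inj₂ (trans (sym (zeroʳ a)) (*-congˡ 0≈b))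

  pos-*-neg : ∀ {a b} → 0# < a → b < 0# → a * b < 0#
  pos-*-neg {a} {b} 0<a b<0 =
    <-resp-≈ (-‿involutive _) ≈-refl (pos-neg (pos-resp (sym (-‿distribʳ-* a b)) (*-pos 0<a (neg-pos b<0))))

  pos-cancelˡ : ∀ {a b} → 0# < a → 0# < a * b → 0# < b
  pos-cancelˡ {a} {b} 0<a 0<ab with <-trichotomy b 0#
  ... | inj₁ b<0        = ⊥-elim (<-irrefl (<-trans 0<ab (pos-*-neg 0<a b<0)))
  ... | inj₂ (inj₁ b≈0) = ⊥-elim (<-irrefl (pos-resp (trans (*-congˡ b≈0) (zeroʳ a)) 0<ab))
  ... | inj₂ (inj₂ 0<b) = 0<b

  nonneg-*-neg⇒zero : ∀ {a b} → 0# ≤ a → 0# ≤ a * b → b < 0# → a ≈ 0#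
  nonneg-*-neg⇒zero (inj₂ 0≈a) _           _   = sym 0≈a
  nonneg-*-neg⇒zero (inj₁ 0<a) (inj₁ 0<ab) b<0 = ⊥-elim (<-irrefl (<-trans 0<ab (pos-*-neg 0<a b<0)))
  nonneg-*-neg⇒zero (inj₁ 0<a) (inj₂ 0≈ab) b<0 = ⊥-elim (<-irrefl (<-resp-≈ (sym 0≈ab) ≈-refl (pos-*-neg 0<a b<0)))

  -- Minors and Pfaffians

  det-cong : ∀ {k} {M N : Matrix F k k} → (∀ a b → M a b ≈ N a b) → det F M ≈ det F N
  det-cong {zero}  M≈N = ≈-refl
  det-cong {suc k} {M} {N} M≈N = ∑-cong expansion
    where
    expansion : ∀ j → sign j * (M zero j * det F (λ a b → M (suc a) (punchIn j b)))
                    ≈ sign j * (N zero j * det F (λ a b → N (suc a) (punchIn j b)))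
    expansion j = *-congˡ (*-cong (M≈N zero j) (det-cong (λ a b → M≈N (suc a) (punchIn j b))))

  pf-cong : ∀ {k} {M N : Matrix F k k} → (∀ a b → M a b ≈ N a b) → pf F M ≈ pf F N
  pf-cong {zero}        M≈N = ≈-refl
  pf-cong {suc zero}    M≈N = ≈-refl
  pf-cong {suc (suc k)} {M} {N} M≈N = ∑-cong expansion
    where
    expansion : ∀ j → sign j * (M zero (suc j) * pf F (λ a b → M (suc (punchIn j a)) (suc (punchIn j b))))
                    ≈ sign j * (N zero (suc j) * pf F (λ a b → N (suc (punchIn j a)) (suc (punchIn j b))))
    expansion j = *-congˡ (*-cong (M≈N zero (suc j)) (pf-cong (λ a b → M≈N (suc (punchIn j a)) (suc (punchIn j b)))))

  module Minors {X Y : Set} (A : X → Y → Carrier) where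

    minor : ∀ {k} → Vector X k → Vector Y k → Carrier
    minor r c = det F (λ a b → A (r a) (c b))

    minor-cong : ∀ {k} {r r′ : Vector X k} {c c′ : Vector Y k} → r ≗ r′ → c ≗ c′ → minor r c ≈ minor r′ c′
    minor-cong r≗r′ c≗c′ = det-cong (λ a b → reflexive (≡.cong₂ A (r≗r′ a) (c≗c′ b)))

    minor-≗ʰ : ∀ {k m} → k ≡ m → {r : Vector X k} {r′ : Vector X m} {c : Vector Y k} {c′ : Vector Y m} →
               r ≗ʰ r′ → c ≗ʰ c′ → minor r c ≈ minor r′ c′
    minor-≗ʰ ≡.refl r≗r′ c≗c′ = minor-cong (λ a → r≗r′ {a} ≡.refl) (λ b → c≗c′ {b} ≡.refl)

    minor-rows-extensional : ∀ {k} (c : Vector Y k) → Extensional (λ r → minor r c)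
    minor-rows-extensional c r≗r′ = minor-cong r≗r′ (λ _ → ≡.refl)

    minor-cols-extensional : ∀ {k} (r : Vector X k) → Extensional (minor r)
    minor-cols-extensional r c≗c′ = minor-cong (λ _ → ≡.refl) c≗c′

    minor-cols-alternating : ∀ {k} (r : Vector X (suc k)) → Alternating (minor r)
    minor-cols-alternating {zero}  r c ()
    minor-cols-alternating {suc k} r =
      laplace-alternating (A (r zero)) (minor-cols-extensional (tail r)) (minor-cols-alternating (tail r))

    minor-rows-alternating : ∀ {k} (c : Vector Y (suc k)) → Alternating (λ r → minor r c)
    minor-rows-alternating {zero}  c r ()
    minor-rows-alternating {suc k} c r zero =
      laplace-laplace-anticomm (A (r (suc zero))) (A (r zero)) (minor-cols-extensional (tail (tail r))) c
    minor-rows-alternating {suc k} c r (suc a) =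
      laplace-neg (A (r zero)) {minor (tail r ∘ swap a)} {minor (tail r)} c (λ j → minor-rows-alternating (removeAt c j) (tail r) a)

    minor-rows-front : ∀ {k} (r : Vector X (suc k)) (c : Vector Y (suc k)) m →
                       minor r c ≈ sign m * minor (r m ∷ removeAt r m) c
    minor-rows-front r c m = sign-swap-sides m (front-sign (minor-rows-extensional c) (minor-rows-alternating c) r m)

  module Pfaffians {X : Set} (A : X → X → Carrier) (skew : ∀ x y → A x y ≈ - A y x) where

    pfMinor : ∀ {k} → Vector X k → Carrier
    pfMinor u = pf F (λ a b → A (u a) (u b))

    pfMinor-extensional : ∀ {k} → Extensional (pfMinor {k})
    pfMinor-extensional u≗v = pf-cong (λ a b → reflexive (≡.cong₂ A (u≗v a) (u≗v b)))

    pfMinor-≗ʰ : ∀ {k m} → k ≡ m → {u : Vector X k} {v : Vector X m} → u ≗ʰ v → pfMinor u ≈ pfMinor v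
    pfMinor-≗ʰ ≡.refl u≗v = pfMinor-extensional (λ a → u≗v {a} ≡.refl)

    pfMinor-odd : ∀ q (u : Vector X (suc (q ℕ.* 2))) → pfMinor u ≈ 0#
    pfMinor-odd zero    u = ≈-refl
    pfMinor-odd (suc q) u = laplace-zero (A (u zero)) {pfMinor} (tail u) (λ j → pfMinor-odd q (removeAt (tail u) j))

    pfMinor-expand₂ : ∀ {k} (u : Vector X (suc (suc (suc (suc k))))) →
      pfMinor u ≈ A (u zero) (u (suc zero)) * pfMinor (tail (tail u))
                  + - laplace (A (u zero)) (laplace (A (u (suc zero))) pfMinor) (tail (tail u))
    pfMinor-expand₂ u = trans (laplace-extensional (A (u zero)) pfMinor-extensional tail≗)
                              (laplace-cons (A (u zero)) pfMinor-extensional (u (suc zero)) (tail (tail u)))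
      where
      tail≗ : tail u ≗ u (suc zero) ∷ tail (tail u)
      tail≗ zero    = ≡.refl
      tail≗ (suc a) = ≡.refl

    pfMinor-swap-first : ∀ {k} (u : Vector X (suc (suc k))) → pfMinor (u ∘ swap zero) ≈ - pfMinor u
    pfMinor-swap-first {zero} u = trans (pf₂ _) (trans (skew _ _) (-‿cong (sym (pf₂ _))))
      where
      pf₂ : ∀ a → 1# * (a * 1#) + 0# ≈ a
      pf₂ a = trans (+-identityʳ _) (trans (*-identityˡ _) (*-identityʳ a))
    pfMinor-swap-first {suc zero} u =
      trans (pfMinor-odd 1 (u ∘ swap zero)) (trans (sym -0#≈0#) (-‿cong (sym (pfMinor-odd 1 u))))
    pfMinor-swap-first {suc (suc k)} u = begin
        pfMinor (u ∘ swap zero)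
      ≈⟨ pfMinor-expand₂ (u ∘ swap zero) ⟩
        A u₁ u₀ * pfMinor t + - laplace (A u₁) (laplace (A u₀) pfMinor) t
      ≈⟨ +-cong (*-congʳ (skew u₁ u₀)) (-‿cong (laplace-laplace-anticomm (A u₁) (A u₀) pfMinor-extensional t)) ⟩
        (- A u₀ u₁) * pfMinor t + - (- laplace (A u₀) (laplace (A u₁) pfMinor) t)
      ≈⟨ +-congʳ (-‿distribˡ-* _ _) ⟨
        - (A u₀ u₁ * pfMinor t) + - (- laplace (A u₀) (laplace (A u₁) pfMinor) t)
      ≈⟨ -‿+-comm _ _ ⟩
        - (A u₀ u₁ * pfMinor t + - laplace (A u₀) (laplace (A u₁) pfMinor) t)
      ≈⟨ -‿cong (pfMinor-expand₂ u) ⟨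
        - pfMinor u
      ∎
      where
      u₀ u₁ : X
      u₀ = u zero
      u₁ = u (suc zero)
      t : Vector X (suc (suc k))
      t = tail (tail u)

    pfMinor-alternating : ∀ {k} → Alternating (pfMinor {suc k})
    pfMinor-alternating {suc k}       u zero    = pfMinor-swap-first u
    pfMinor-alternating {suc (suc k)} u (suc a) =
      laplace-alternating (A (u zero)) pfMinor-extensional pfMinor-alternating (tail u) a

    -- Alternation only gives 2 · pf = 0; the ordering rules out characteristic 2.
    pfMinor-repeated : ∀ {k} x (u : Vector X k) → pfMinor (x ∷ x ∷ u) ≈ 0#
    pfMinor-repeated x u = x≈-x⇒x≈0 (trans (pfMinor-extensional swap-fixes) (pfMinor-swap-first (x ∷ x ∷ u)))
      where
      swap-fixes : x ∷ x ∷ u ≗ (x ∷ x ∷ u) ∘ swap zero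
      swap-fixes zero          = ≡.refl
      swap-fixes (suc zero)    = ≡.refl
      swap-fixes (suc (suc a)) = ≡.refl

    open Minors A

    minor≈pf*pf-even : ∀ q (t : Vector X (q ℕ.* 2)) x y → minor (x ∷ t) (y ∷ t) ≈ pfMinor t * pfMinor (x ∷ y ∷ t)
    minor≈pf*pf-odd  : ∀ q (t : Vector X (suc (q ℕ.* 2))) x y → minor (x ∷ t) (y ∷ t) ≈ pfMinor (x ∷ t) * pfMinor (y ∷ t)

    minor≈pf*pf-even zero    t x y = sym (*-identityˡ _)
    minor≈pf*pf-even (suc q) t x y = begin
        laplace (A x) (minor t) (y ∷ t)
      ≈⟨ laplace-cons (A x) (minor-cols-extensional t) y t ⟩
        A x y * minor t t + - ∑ F (λ m → sign m * (A x (t m) * minor t (y ∷ removeAt t m)))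
      ≈⟨ +-cong (*-congˡ diagonal) (-‿cong (trans (∑-cong off-diagonal) (sym (*-∑ (P t) rest)))) ⟩
        A x y * (P t * P t) + - (P t * ∑ F rest)
      ≈⟨ +-cong (solve 2 (λ a p → (a ⊛ (p ⊛ p)) ⊜ (p ⊛ (a ⊛ p))) ≈-refl (A x y) (P t)) (-‿distribʳ-* _ _) ⟩
        P t * (A x y * P t) + P t * - ∑ F rest
      ≈⟨ distribˡ _ _ _ ⟨
        P t * (A x y * P t + - ∑ F rest)
      ≈⟨ *-congˡ (laplace-cons (A x) pfMinor-extensional y t) ⟨
        P t * P (x ∷ y ∷ t)
      ∎
      where
      P : ∀ {k} → Vector X k → Carrier
      P = pfMinor
      rest : Vector Carrier (suc q ℕ.* 2)
      rest m = sign m * (A x (t m) * P (y ∷ removeAt t m))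
      P-head∷tail : ∀ {k} (w : Vector X (suc k)) → P w ≈ P (w zero ∷ tail w)
      P-head∷tail w = pfMinor-extensional (head∷tail w)
      diagonal : minor t t ≈ P t * P t
      diagonal = begin
        minor t t                                              ≈⟨ minor-cong (head∷tail t) (head∷tail t) ⟩
        minor (t zero ∷ tail t) (t zero ∷ tail t)              ≈⟨ minor≈pf*pf-odd q (tail t) (t zero) (t zero) ⟩
        P (t zero ∷ tail t) * P (t zero ∷ tail t)              ≈⟨ *-cong (P-head∷tail t) (P-head∷tail t) ⟨
        P t * P t                                              ∎
      off-diagonal : ∀ m → sign m * (A x (t m) * minor t (y ∷ removeAt t m)) ≈ P t * rest m
      off-diagonal m = begin
          sign m * (A x (t m) * minor t (y ∷ removeAt t m))
        ≈⟨ *-congˡ (*-congˡ (minor-rows-front t (y ∷ removeAt t m) m)) ⟩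
          sign m * (A x (t m) * (sign m * minor (t m ∷ removeAt t m) (y ∷ removeAt t m)))
        ≈⟨ *-congˡ (*-congˡ (*-congˡ (minor≈pf*pf-odd q (removeAt t m) (t m) y))) ⟩
          sign m * (A x (t m) * (sign m * (P (t m ∷ removeAt t m) * P (y ∷ removeAt t m))))
        ≈⟨ *-congˡ (*-congˡ (*-congˡ (*-congʳ (front-sign pfMinor-extensional pfMinor-alternating t m)))) ⟩
          sign m * (A x (t m) * (sign m * ((sign m * P t) * P (y ∷ removeAt t m))))
        ≈⟨ solve 5 (λ s a s′ p c → (s ⊛ (a ⊛ (s′ ⊛ ((s′ ⊛ p) ⊛ c))))  ⊜ ((s′ ⊛ s′) ⊛ (p ⊛ (s ⊛ (a ⊛ c))))) ≈-refl
                   (sign m) (A x (t m)) (sign m) (P t) (P (y ∷ removeAt t m)) ⟩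
          (sign m * sign m) * (P t * rest m)
        ≈⟨ trans (*-congʳ (sgn-square (toℕ m))) (*-identityˡ _) ⟩
          P t * rest m
        ∎

    minor≈pf*pf-odd q t x y = begin
        laplace (A x) (minor t) (y ∷ t)
      ≈⟨ laplace-cons (A x) (minor-cols-extensional t) y t ⟩
        A x y * minor t t + - ∑ F (λ m → sign m * (A x (t m) * minor t (y ∷ removeAt t m)))
      ≈⟨ +-cong (*-congˡ diagonal)
                (-‿cong (trans (∑-cong off-diagonal) (sym (∑-* (λ m → sign (suc m) * expansion m) (P (y ∷ t)))))) ⟩
        A x y * 0# + - (∑ F (λ m → sign (suc m) * expansion m) * P (y ∷ t))
      ≈⟨ +-cong (zeroʳ _) (-‿cong (*-congʳ (∑-sign-suc expansion))) ⟩
        0# + - ((- P (x ∷ t)) * P (y ∷ t))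
      ≈⟨ +-identityˡ _ ⟩
        - ((- P (x ∷ t)) * P (y ∷ t))
      ≈⟨ -‿cong (-‿distribˡ-* _ _) ⟨
        - (- (P (x ∷ t) * P (y ∷ t)))
      ≈⟨ -‿involutive _ ⟩
        P (x ∷ t) * P (y ∷ t)
      ∎
      where
      P : ∀ {k} → Vector X k → Carrier
      P = pfMinor
      expansion : Vector Carrier (suc (q ℕ.* 2))
      expansion m = A x (t m) * P (removeAt t m)
      diagonal : minor t t ≈ 0#
      diagonal = begin
        minor t t                                              ≈⟨ minor-cong (head∷tail t) (head∷tail t) ⟩
        minor (t zero ∷ tail t) (t zero ∷ tail t)              ≈⟨ minor≈pf*pf-even q (tail t) (t zero) (t zero) ⟩
        P (tail t) * P (t zero ∷ t zero ∷ tail t)              ≈⟨ *-congˡ (pfMinor-repeated (t zero) (tail t)) ⟩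
        P (tail t) * 0#                                        ≈⟨ zeroʳ _ ⟩
        0#                                                     ∎
      off-diagonal : ∀ m → sign m * (A x (t m) * minor t (y ∷ removeAt t m)) ≈ (sign (suc m) * expansion m) * P (y ∷ t)
      off-diagonal m = begin
          sign m * (A x (t m) * minor t (y ∷ removeAt t m))
        ≈⟨ *-congˡ (*-congˡ (minor-rows-front t (y ∷ removeAt t m) m)) ⟩
          sign m * (A x (t m) * (sign m * minor (t m ∷ removeAt t m) (y ∷ removeAt t m)))
        ≈⟨ *-congˡ (*-congˡ (*-congˡ (minor≈pf*pf-even q (removeAt t m) (t m) y))) ⟩
          sign m * (A x (t m) * (sign m * (P (removeAt t m) * P (t m ∷ y ∷ removeAt t m))))
        ≈⟨ *-congˡ (*-congˡ (*-congˡ (*-congˡ pulled))) ⟩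
          sign m * (A x (t m) * (sign m * (P (removeAt t m) * (sign (suc m) * P (y ∷ t)))))
        ≈⟨ solve 6 (λ s a s′ p s″ c → (s ⊛ (a ⊛ (s′ ⊛ (p ⊛ (s″ ⊛ c)))))  ⊜ ((s ⊛ s′) ⊛ ((s″ ⊛ (a ⊛ p)) ⊛ c))) ≈-refl
                   (sign m) (A x (t m)) (sign m) (P (removeAt t m)) (sign (suc m)) (P (y ∷ t)) ⟩
          (sign m * sign m) * ((sign (suc m) * expansion m) * P (y ∷ t))
        ≈⟨ trans (*-congʳ (sgn-square (toℕ m))) (*-identityˡ _) ⟩
          (sign (suc m) * expansion m) * P (y ∷ t)
        ∎
        where
        reordered : t m ∷ y ∷ removeAt t m ≗ (y ∷ t) (suc m) ∷ removeAt (y ∷ t) (suc m)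
        reordered zero    = ≡.refl
        reordered (suc a) = ≡.sym (removeAt-∷-suc y t m a)
        pulled : P (t m ∷ y ∷ removeAt t m) ≈ sign (suc m) * P (y ∷ t)
        pulled = trans (pfMinor-extensional reordered) (front-sign pfMinor-extensional pfMinor-alternating (y ∷ t) (suc m))

    minor≈pf*pf : ∀ {k} → 2 ∣ k → ∀ (t : Vector X k) x y → minor (x ∷ t) (y ∷ t) ≈ pfMinor t * pfMinor (x ∷ y ∷ t)
    minor≈pf*pf (divides q ≡.refl) = minor≈pf*pf-even q

  -- Principal Pfaffians and almost-principal minors

  module _ {n} (A : Matrix F n n) (skew : SkewSymmetric F A) where
    open Minors A
    open Pfaffians A skew

    EveryPrincipalPf : (Carrier → Set ℓ) → Set ℓ
    EveryPrincipalPf Q = ∀ (I : Subset n) → 2 ∣ ∣ I ∣ → Q (principalPf F A I)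

    EveryAlmostPrincipalMinor : (Carrier → Set ℓ) → Set ℓ
    EveryAlmostPrincipalMinor Q =
      ∀ (I : Subset n) → 2 ∣ ∣ I ∣ → (i j : Fin n) → i <ᶠ j → (i∉I : i ∉ I) → (j∉I : j ∉ I) →
        Q (almostPrincipalDet F A I i j i∉I j∉I)

    principalPf-∪⁅⁆ : ∀ S {x} → x ∉ S → principalPf F A (S ∪ ⁅ x ⁆) ≈ sign (rank S x) * pfMinor (x ∷ enum S)
    principalPf-∪⁅⁆ S {x} x∉S = trans (pfMinor-≗ʰ (∣∪⁅⁆∣ S x x∉S) (enum-∪⁅⁆ S x x∉S))
                                      (insertAt-sign pfMinor-extensional pfMinor-alternating (enum S) (rank S x) x)

    almostPrincipalDet-front : ∀ I {i j} (i∉I : i ∉ I) (j∉I : j ∉ I) →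
      almostPrincipalDet F A I i j i∉I j∉I ≈ sign (rank I i) * (sign (rank I j) * minor (i ∷ enum I) (j ∷ enum I))
    almostPrincipalDet-front I {i} {j} i∉I j∉I = begin
        almostPrincipalDet F A I i j i∉I j∉I
      ≈⟨ minor-≗ʰ (∣∪⁅⁆∣ I i i∉I) (enum-∪⁅⁆ I i i∉I)
                  (≗ʰ-cast (≡.trans (∣∪⁅⁆∣ I i i∉I) (≡.sym (∣∪⁅⁆∣ I j j∉I))) (enum-∪⁅⁆ I j j∉I)) ⟩
        minor (insertAt u p i) (insertAt u q j)
      ≈⟨ insertAt-sign (minor-rows-extensional (insertAt u q j)) (minor-rows-alternating (insertAt u q j)) u p i ⟩
        sign p * minor (i ∷ u) (insertAt u q j)
      ≈⟨ *-congˡ (insertAt-sign (minor-cols-extensional (i ∷ u)) (minor-cols-alternating (i ∷ u)) u q j) ⟩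
        sign p * (sign q * minor (i ∷ u) (j ∷ u))
      ∎
      where
      u = enum I
      p = rank I i
      q = rank I j

    almostPrincipalDet≈pf*pf : ∀ I {i j} → i <ᶠ j → (i∉I : i ∉ I) (j∉I : j ∉ I) → 2 ∣ ∣ I ∣ →
      almostPrincipalDet F A I i j i∉I j∉I ≈ principalPf F A I * principalPf F A ((I ∪ ⁅ i ⁆) ∪ ⁅ j ⁆)
    almostPrincipalDet≈pf*pf I {i} {j} i<j i∉I j∉I 2∣∣I∣ = begin
        almostPrincipalDet F A I i j i∉I j∉I
      ≈⟨ almostPrincipalDet-front I i∉I j∉I ⟩
        sign p * (sign q * minor (i ∷ u) (j ∷ u))
      ≈⟨ *-congˡ (*-congˡ (minor≈pf*pf 2∣∣I∣ u i j)) ⟩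
        sign p * (sign q * (pfMinor u * X))
      ≈⟨ solve 4 (λ s s′ a b → (s ⊛ (s′ ⊛ (a ⊛ b))) ⊜ (a ⊛ (s′ ⊛ (s ⊛ b)))) ≈-refl (sign p) (sign q) (pfMinor u) X ⟩
        pfMinor u * (sign q * (sign p * X))
      ≈⟨ *-congˡ (trans (*-congˡ (sym (-‿distribˡ-* _ _))) (-x*-y≈x*y _ _)) ⟨
        pfMinor u * ((- sign q) * (- sign p * X))
      ≈⟨ *-congˡ pf-J ⟨
        principalPf F A I * principalPf F A ((I ∪ ⁅ i ⁆) ∪ ⁅ j ⁆)
      ∎
      where
      u = enum I
      p = rank I i
      q = rank I j
      X = pfMinor (i ∷ j ∷ u)
      pf-J : principalPf F A ((I ∪ ⁅ i ⁆) ∪ ⁅ j ⁆) ≈ (- sign q) * (- sign p * X)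
      pf-J = begin
          principalPf F A ((I ∪ ⁅ i ⁆) ∪ ⁅ j ⁆)
        ≈⟨ principalPf-∪⁅⁆ (I ∪ ⁅ i ⁆) (∉-∪⁅⁆ I j∉I i<j) ⟩
          sign (rank (I ∪ ⁅ i ⁆) j) * pfMinor (j ∷ enum (I ∪ ⁅ i ⁆))
        ≈⟨ *-cong (reflexive (≡.cong (sgn F) (rank-∪⁅⁆ I i∉I i<j)))
                  (pfMinor-≗ʰ (≡.cong suc (∣∪⁅⁆∣ I i i∉I)) (∷-≗ʰ j (enum-∪⁅⁆ I i i∉I))) ⟩
          (- sign q) * pfMinor (insertAt (j ∷ u) (suc p) i)
        ≈⟨ *-congˡ (insertAt-sign pfMinor-extensional pfMinor-alternating (j ∷ u) (suc p) i) ⟩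
          (- sign q) * (- sign p * X)
        ∎

    principalPf-empty : ∀ (J : Subset n) → ∣ J ∣ ≡ 0 → principalPf F A J ≈ 1#
    principalPf-empty J ∣J∣≡0 = pfMinor-≗ʰ ∣J∣≡0 {v = λ ()} (λ { {b = ()} })

    module _ {Q : Carrier → Set ℓ} (Q-resp : ∀ {a b} → a ≈ b → Q a → Q b) where

      pfs⇒minors : (∀ {a b} → Q a → Q b → Q (a * b)) → EveryPrincipalPf Q → EveryAlmostPrincipalMinor Q
      pfs⇒minors Q-* pfsQ I 2∣∣I∣ i j i<j i∉I j∉I =
        Q-resp (sym (almostPrincipalDet≈pf*pf I i<j i∉I j∉I 2∣∣I∣)) (Q-* (pfsQ I 2∣∣I∣) (pfsQ J 2∣∣J∣))
        where
        J = (I ∪ ⁅ i ⁆) ∪ ⁅ j ⁆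
        2∣∣J∣ : 2 ∣ ∣ J ∣
        2∣∣J∣ = ≡.subst (2 ∣_) (≡.sym (∣∪⁅⁆∪⁅⁆∣ I i∉I j∉I i<j)) (∣m∣n⇒∣m+n ∣-refl 2∣∣I∣)

      minors⇒pf*pf : EveryAlmostPrincipalMinor Q → ∀ I {x y} → x ∉ I → y ∉ I → x ≢ y → 2 ∣ ∣ I ∣ →
                     Q (principalPf F A I * principalPf F A ((I ∪ ⁅ x ⁆) ∪ ⁅ y ⁆))
      minors⇒pf*pf minorsQ I {x} {y} x∉I y∉I x≢y 2∣∣I∣ with <-cmp x y
      ... | tri< x<y _ _ = Q-resp (almostPrincipalDet≈pf*pf I x<y x∉I y∉I 2∣∣I∣) (minorsQ I 2∣∣I∣ x y x<y x∉I y∉I)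
      ... | tri≈ _ x≡y _ = ⊥-elim (x≢y x≡y)
      ... | tri> _ _ y<x = Q-resp (trans (almostPrincipalDet≈pf*pf I y<x y∉I x∉I 2∣∣I∣)
                                         (*-congˡ (reflexive (≡.cong (principalPf F A) (∪⁅⁆-swap I y x)))))
                                  (minorsQ I 2∣∣I∣ y x y<x y∉I x∉I)

      minors⇒pf*pf-extracted : EveryAlmostPrincipalMinor Q → ∀ {J : Subset n} {p p′} (ex : Extraction J p)
                               (ey : Extraction (Extraction.rest ex) p′) → 2 ∣ ∣ Extraction.rest ey ∣ →
                               Q (principalPf F A (Extraction.rest ey) * principalPf F A J)
      minors⇒pf*pf-extracted minorsQ ex ey 2∣∣I∣ =
        ≡.subst (λ S → Q (principalPf F A (Extraction.rest ey) * principalPf F A S)) (≡.sym (nested-extraction-≡ ex ey))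
          (minors⇒pf*pf minorsQ _ (Extraction.elem∉ ey) (outer∉inner-rest ex ey) (inner≢outer ex ey) 2∣∣I∣)

    minors⇒pfs-pos : EveryAlmostPrincipalMinor (0# <_) → EveryPrincipalPf (0# <_)
    minors⇒pfs-pos minorsPos J (divides q ∣J∣≡) = go q J ∣J∣≡
      where
      go : ∀ q J → ∣ J ∣ ≡ q ℕ.* 2 → 0# < principalPf F A J
      go zero    J ∣J∣≡0 = pos-resp (sym (principalPf-empty J ∣J∣≡0)) 0<1
      go (suc q) J ∣J∣≡  =
        pos-cancelˡ (go q I ∣I∣≡) (minors⇒pf*pf-extracted pos-resp minorsPos ex ey (divides q ∣I∣≡))
        where
        ex = extractAt J ∣J∣≡ zero
        ∣K∣≡ = rest-size ex ∣J∣≡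
        ey = extractAt (Extraction.rest ex) ∣K∣≡ zero
        I = Extraction.rest ey
        ∣I∣≡ = rest-size ey ∣K∣≡

    negative-pf-vanishes : EveryAlmostPrincipalMinor (0# ≤_) → ∀ q (J : Subset n) → ∣ J ∣ ≡ suc q ℕ.* 2 →
                           (∀ I → ∣ I ∣ ≡ q ℕ.* 2 → 0# ≤ principalPf F A I) →
                           principalPf F A J < 0# → principalPf F A J ≈ 0#
    negative-pf-vanishes minorsNonneg q J ∣J∣≡ pfsNonneg pfJ<0 = begin
        principalPf F A J
      ≈⟨ reflexive (≡.cong (principalPf F A) (Extraction.J≡ ex)) ⟩
        principalPf F A (K ∪ ⁅ x ⁆)
      ≈⟨ principalPf-∪⁅⁆ K (Extraction.elem∉ ex) ⟩
        sign (rank K x) * pfMinor (x ∷ enum K)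
      ≈⟨ *-cong (reflexive (≡.cong (sgn F) (Extraction.rank≡ ex)))
                (pfMinor-≗ʰ (≡.cong suc ∣K∣≡) (∷-≗ʰ x (≗ʰ-sym v≗ʰenum))) ⟩
        1# * laplace (A x) pfMinor v
      ≈⟨ *-congˡ (laplace-zero (A x) {pfMinor} v minor-vanishes) ⟩
        1# * 0#
      ≈⟨ zeroʳ 1# ⟩
        0#
      ∎
      where
      ex = extractAt J ∣J∣≡ zero
      K = Extraction.rest ex
      x = Extraction.elem ex
      ∣K∣≡ = rest-size ex ∣J∣≡
      v : Vector (Fin n) (suc (q ℕ.* 2))
      v = enum K ∘ cast (≡.sym ∣K∣≡)
      v≗ʰenum : v ≗ʰ enum K
      v≗ʰenum = ≗ʰ-cast (≡.sym ∣K∣≡) (enum-cong {S = K} ≡.refl)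
      minor-vanishes : ∀ l → pfMinor (removeAt v l) ≈ 0#
      minor-vanishes l = begin
          pfMinor (removeAt v l)
        ≈⟨ pfMinor-≗ʰ (≡.sym ∣I∣≡)
                      (removeAt-≗ʰ (≗ʰ-cast (≡.sym ∣K∣≡) (enum-extraction ey)) (≡.sym (Extraction.rank≡ ey))) ⟩
          principalPf F A I
        ≈⟨ nonneg-*-neg⇒zero (pfsNonneg I ∣I∣≡)
                             (minors⇒pf*pf-extracted nonneg-resp minorsNonneg ex ey (divides q ∣I∣≡)) pfJ<0 ⟩
          0#
        ∎
        where
        ey = extractAt K ∣K∣≡ l
        I = Extraction.rest ey
        ∣I∣≡ = rest-size ey ∣K∣≡

    minors⇒pfs-nonneg : EveryAlmostPrincipalMinor (0# ≤_) → EveryPrincipalPf (0# ≤_)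
    minors⇒pfs-nonneg minorsNonneg J (divides q ∣J∣≡) = go q J ∣J∣≡
      where
      go : ∀ q J → ∣ J ∣ ≡ q ℕ.* 2 → 0# ≤ principalPf F A J
      go zero    J ∣J∣≡0 = inj₁ (pos-resp (sym (principalPf-empty J ∣J∣≡0)) 0<1)
      go (suc q) J ∣J∣≡ with <-trichotomy 0# (principalPf F A J)
      ... | inj₁ 0<pfJ        = inj₁ 0<pfJ
      ... | inj₂ (inj₁ 0≈pfJ) = inj₂ 0≈pfJ
      ... | inj₂ (inj₂ pfJ<0) =
        ⊥-elim (<-irrefl (<-resp-≈ (negative-pf-vanishes minorsNonneg q J ∣J∣≡ (go q) pfJ<0) ≈-refl pfJ<0))

proposition5p6 : ∀ {c ℓ} (F : OrderedField c ℓ) (n : ℕ) (A : Matrix F n n) →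
    SkewSymmetric F A →
    ((∀ (I : Subset n) → 2 ∣ ∣ I ∣ → OrderedField._<_ F (OrderedField.0# F) (principalPf F A I))
      ⇔
     (∀ (I : Subset n) → 2 ∣ ∣ I ∣ → (i j : Fin n) → i <ᶠ j → (i∉I : i ∉ I) → (j∉I : j ∉ I) →
        OrderedField._<_ F (OrderedField.0# F) (almostPrincipalDet F A I i j i∉I j∉I)))
    ×
    ((∀ (I : Subset n) → 2 ∣ ∣ I ∣ → OrderedField._≤_ F (OrderedField.0# F) (principalPf F A I))
      ⇔
     (∀ (I : Subset n) → 2 ∣ ∣ I ∣ → (i j : Fin n) → i <ᶠ j → (i∉I : i ∉ I) → (j∉I : j ∉ I) →
        OrderedField._≤_ F (OrderedField.0# F) (almostPrincipalDet F A I i j i∉I j∉I)))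
proposition5p6 F n A skew =
  mk⇔ (pfs⇒minors F A skew (pos-resp F) (OrderedField.*-pos F)) (minors⇒pfs-pos F A skew) ,
  mk⇔ (pfs⇒minors F A skew (nonneg-resp F) (nonneg-* F)) (minors⇒pfs-nonneg F A skew)
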